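{- Let $T$ be a tree of pairs $(u,v)$ with $u,v\in\omega^{<\omega}$ of equal length, closed under taking pairs of initial segments of equal length, and let $[T]=\{(x,y)\in\omega^\omega\times\omega^\omega:\forall n\ (x\upharpoonright n,y\upharpoonright n)\in T\}$. For $s,t\in\omega^{<\omega}$ let $A_{s,t}=\{x\in\omega^\omega: s\subseteq x \text{ and } \exists y\in\omega^\omega\,(t\subseteq y \wedge (x,y)\in[T])\}$. Let $s,t\in\omega^{<\omega}$ and suppose that $A_{s,t}\cap[H]\neq\emptyset$ for every Hechler tree $H$ with root $s$. Then there are infinitely many $n\in\omega$ such that $A_{sn,t}\cap[H]\neq\emptyset$ for every Hechler tree $H$ with root $sn$.
   Context: For $s\in\omega^{<\omega}$ and $n\in\omega$, $sn$ denotes the one-term extension of $s$ by $n$. For a tree $H\subseteq\omega^{<\omega}$ (nonempty, closed under initial segments), $[H]=\{x\in\omega^\omega:\forall n\ x\upharpoonright n\in H\}$. A tree $H\subseteq\omega^{<\omega}$ is a Hechler tree with root $s$ iff $s\in H$, every $r\in H$ satisfies $s\subseteq r$ or $r\subseteq s$, and for every $r\in H$ with $s\subseteq r$, $rn\in H$ for all but finitely many $n\in\omega$. -}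

module Defs where

open import Data.Nat using (ℕ; _≤_)
open import Data.List using (List; []; _∷_; _++_; map; upTo; length; take; _∷ʳ_)
open import Data.Product using (Σ; ∃; _×_)
open import Data.Sum using (_⊎_)
open import Relation.Binary.PropositionalEquality using (_≡_)

-- ω^{<ω} is List ℕ ; ω^ω is ℕ → ℕ.

restrict : (ℕ → ℕ) → ℕ → List ℕ
restrict x n = map x (upTo n)

_⊑_ : List ℕ → List ℕ → Set
u ⊑ v = Σ (List ℕ) λ w → u ++ w ≡ v

_≺_ : List ℕ → (ℕ → ℕ) → Set
s ≺ x = restrict x (length s) ≡ s

record PairTree (T : List ℕ → List ℕ → Set) : Set where
  field
    equal-length : ∀ u v → T u v → length u ≡ length v
    closed       : ∀ u v → T u v → ∀ k → T (take k u) (take k v)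

PairBody : (List ℕ → List ℕ → Set) → (ℕ → ℕ) → (ℕ → ℕ) → Set
PairBody T x y = ∀ n → T (restrict x n) (restrict y n)

A : (List ℕ → List ℕ → Set) → List ℕ → List ℕ → (ℕ → ℕ) → Set
A T s t x = s ≺ x × ∃ λ (y : ℕ → ℕ) → t ≺ y × PairBody T x y

Body : (List ℕ → Set) → (ℕ → ℕ) → Set
Body H x = ∀ n → H (restrict x n)

record Hechler (H : List ℕ → Set) (s : List ℕ) : Set where
  field
    root-mem   : H s
    tree       : ∀ r → H r → ∀ u → u ⊑ r → H u
    comparable : ∀ r → H r → s ⊑ r ⊎ r ⊑ s
    cofinite   : ∀ r → H r → s ⊑ r → ∃ λ m → ∀ n → m ≤ n → H (r ∷ʳ n)

Positive : (List ℕ → List ℕ → Set) → List ℕ → List ℕ → Set₁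
Positive T s t = ∀ (H : List ℕ → Set) → Hechler H s → ∃ λ x → A T s t x × Body H x

-- Suppose that for every n ≥ m some Hechler tree H_n with root s⌢n misses A_{s⌢n,t}
-- (picking H_n needs excluded middle). Glue the initial segments of s and all these H_n
-- into one Hechler tree H with root s: above s its n-th successor is split off only for
-- n ≥ m, which is a cofinite set. By hypothesis some x ∈ A_{s,t} lies on a branch of H;
-- with n = x(|s|) that branch runs through H_n and x ∈ A_{s⌢n,t}, a contradiction.
module Submission where

open import Defs
open import Level using (0ℓ; lift; lower) renaming (suc to lsuc)
open import Axiom.ExcludedMiddle using (ExcludedMiddle)
open import Data.Nat using (ℕ; suc; _≤_; _<_; _+_; z≤n; s≤s; _≤′_; ≤′-refl; ≤′-step)
open import Data.Nat.Properties using (+-comm; <⇒≱; ≤⇒≤′; m≤m+n; m≤n+m; m<m+n)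
open import Data.List using (List; []; _∷_; _++_; [_]; map; upTo; length; _∷ʳ_)
open import Data.List.Properties
  using (length-++; ++-identityʳ; ++-assoc; ++-cancelˡ; ∷-injective; map-++; upTo-∷ʳ)
open import Data.Product using (Σ; ∃; _×_; _,_; proj₁; proj₂)
open import Data.Sum using (_⊎_; inj₁; inj₂)
open import Data.Empty using (⊥; ⊥-elim)
open import Relation.Nullary using (¬_; Dec; yes; no)
open import Relation.Nullary.Decidable using (decidable-stable)
open import Relation.Binary.PropositionalEquality
  using (_≡_; refl; sym; trans; cong; subst; module ≡-Reasoning)

⊑-refl : ∀ u → u ⊑ u
⊑-refl u = [] , ++-identityʳ u

⊑-reflexive : ∀ {u v} → u ≡ v → u ⊑ v
⊑-reflexive {u} refl = ⊑-refl u

⊑-trans : ∀ {u v w} → u ⊑ v → v ⊑ w → u ⊑ w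
⊑-trans {u} (p , refl) (q , refl) = p ++ q , sym (++-assoc u p q)

⊑-∷ʳ : ∀ u n → u ⊑ (u ∷ʳ n)
⊑-∷ʳ u n = [ n ] , refl

length-∷ʳ : ∀ (u : List ℕ) n → length (u ∷ʳ n) ≡ suc (length u)
length-∷ʳ u n = trans (length-++ u) (+-comm (length u) 1)

⊑⇒length-≤ : ∀ {u v} → u ⊑ v → length u ≤ length v
⊑⇒length-≤ {u} (w , refl) = subst (length u ≤_) (sym (length-++ u)) (m≤m+n _ _)

⊑⇒≡⊎length-< : ∀ {u v} → u ⊑ v → u ≡ v ⊎ length u < length v
⊑⇒≡⊎length-< {u} ([] , refl) = inj₁ (sym (++-identityʳ u))
⊑⇒≡⊎length-< {u} (k ∷ w , refl) =
  inj₂ (subst (length u <_) (sym (length-++ u)) (m<m+n (length u) (s≤s z≤n)))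

⊑∧length-≥⇒≡ : ∀ {u v} → u ⊑ v → length v ≤ length u → u ≡ v
⊑∧length-≥⇒≡ u⊑v v≤u with ⊑⇒≡⊎length-< u⊑v
... | inj₁ u≡v = u≡v
... | inj₂ u<v = ⊥-elim (<⇒≱ u<v v≤u)

∷ʳ-⊑⇒length-< : ∀ {u n v} → (u ∷ʳ n) ⊑ v → length u < length v
∷ʳ-⊑⇒length-< {u} {n} {v} p = subst (_≤ length v) (length-∷ʳ u n) (⊑⇒length-≤ p)

⊑-comparable : ∀ u v {w} → u ⊑ w → v ⊑ w → u ⊑ v ⊎ v ⊑ u
⊑-comparable []      v       _             _  = inj₁ (v , refl)
⊑-comparable (a ∷ u) []      _             _  = inj₂ (a ∷ u , refl)
⊑-comparable (a ∷ u) (b ∷ v) (p , refl) (q , eq) with refl , eq′ ← ∷-injective eq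
  with ⊑-comparable u v (p , refl) (q , eq′)
... | inj₁ (r , refl) = inj₁ (r , refl)
... | inj₂ (r , refl) = inj₂ (r , refl)

∷ʳ-⊑-unique : ∀ u {a b v} → (u ∷ʳ a) ⊑ v → (u ∷ʳ b) ⊑ v → a ≡ b
∷ʳ-⊑-unique u {a} {b} (p , refl) (q , eq) =
  proj₁ (∷-injective (++-cancelˡ u (a ∷ p) (b ∷ q) (begin
    u ++ a ∷ p       ≡⟨ ++-assoc u [ a ] p ⟨
    (u ∷ʳ a) ++ p    ≡⟨ eq ⟨
    (u ∷ʳ b) ++ q    ≡⟨ ++-assoc u [ b ] q ⟩
    u ++ b ∷ q       ∎)))
  where open ≡-Reasoning

restrict-suc : ∀ x n → restrict x (suc n) ≡ restrict x n ∷ʳ x n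
restrict-suc x n = begin
  map x (upTo (suc n))     ≡⟨ cong (map x) (upTo-∷ʳ n) ⟨
  map x (upTo n ∷ʳ n)      ≡⟨ map-++ x (upTo n) [ n ] ⟩
  restrict x n ∷ʳ x n      ∎
  where open ≡-Reasoning

restrict-mono : ∀ x {a b} → a ≤ b → restrict x a ⊑ restrict x b
restrict-mono x a≤b = go (≤⇒≤′ a≤b)
  where
  go : ∀ {a b} → a ≤′ b → restrict x a ⊑ restrict x b
  go ≤′-refl = ⊑-refl _
  go (≤′-step {n} a≤′n) =
    ⊑-trans (go a≤′n) (⊑-trans (⊑-∷ʳ (restrict x n) (x n)) (⊑-reflexive (sym (restrict-suc x n))))

≺⇒restrict-suc : ∀ {s x} → s ≺ x → restrict x (suc (length s)) ≡ s ∷ʳ x (length s)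
≺⇒restrict-suc {s} {x} s≺x = trans (restrict-suc x (length s)) (cong (_∷ʳ x (length s)) s≺x)

≺-∷ʳ : ∀ {s x} → s ≺ x → (s ∷ʳ x (length s)) ≺ x
≺-∷ʳ {s} {x} s≺x =
  trans (cong (restrict x) (length-∷ʳ s _)) (≺⇒restrict-suc s≺x)

module Gluing (s : List ℕ) (m : ℕ) (Hs : ℕ → List ℕ → Set)
              (Hs-hechler : ∀ {n} → m ≤ n → Hechler (Hs n) (s ∷ʳ n)) where

  Glued : List ℕ → Set
  Glued r = r ⊑ s ⊎ ∃ λ n → m ≤ n × Hs n r

  private
    module Hs {n} (m≤n : m ≤ n) = Hechler (Hs-hechler m≤n)

  glued-above-root : ∀ {r} → Glued r → length s < length r →
                     ∃ λ n → m ≤ n × Hs n r × (s ∷ʳ n) ⊑ r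
  glued-above-root (inj₁ r⊑s) s<r = ⊥-elim (<⇒≱ s<r (⊑⇒length-≤ r⊑s))
  glued-above-root {r} (inj₂ (n , m≤n , h)) s<r with Hs.comparable m≤n r h
  ... | inj₁ sn⊑r = n , m≤n , h , sn⊑r
  ... | inj₂ r⊑sn = n , m≤n , h , ⊑-reflexive (sym (⊑∧length-≥⇒≡ r⊑sn sn≤r))
    where
    sn≤r : length (s ∷ʳ n) ≤ length r
    sn≤r = subst (_≤ length r) (sym (length-∷ʳ s n)) s<r

  glued-above : ∀ {n r} → Glued r → (s ∷ʳ n) ⊑ r → m ≤ n × Hs n r
  glued-above {n} g sn⊑r with glued-above-root g (∷ʳ-⊑⇒length-< sn⊑r)
  ... | n′ , m≤n′ , h , sn′⊑r with refl ← ∷ʳ-⊑-unique s sn⊑r sn′⊑r = m≤n′ , h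

  glued-hechler : Hechler Glued s
  glued-hechler = record
    { root-mem   = inj₁ (⊑-refl s)
    ; tree       = tree
    ; comparable = comparable
    ; cofinite   = cofinite
    }
    where
    tree : ∀ r → Glued r → ∀ u → u ⊑ r → Glued u
    tree r (inj₁ r⊑s)            u u⊑r = inj₁ (⊑-trans u⊑r r⊑s)
    tree r (inj₂ (n , m≤n , h)) u u⊑r = inj₂ (n , m≤n , Hs.tree m≤n r h u u⊑r)

    comparable : ∀ r → Glued r → s ⊑ r ⊎ r ⊑ s
    comparable r (inj₁ r⊑s) = inj₂ r⊑s
    comparable r (inj₂ (n , m≤n , h)) with Hs.comparable m≤n r h
    ... | inj₁ sn⊑r = inj₁ (⊑-trans (⊑-∷ʳ s n) sn⊑r)
    ... | inj₂ r⊑sn = ⊑-comparable s r (⊑-∷ʳ s n) r⊑sn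

    cofinite : ∀ r → Glued r → s ⊑ r → ∃ λ k → ∀ n → k ≤ n → Glued (r ∷ʳ n)
    cofinite r g s⊑r with ⊑⇒≡⊎length-< s⊑r
    ... | inj₁ refl = m , λ n m≤n → inj₂ (n , m≤n , Hs.root-mem m≤n)
    ... | inj₂ s<r with glued-above-root g s<r
    ...   | n , m≤n , h , sn⊑r with Hs.cofinite m≤n r h sn⊑r
    ...     | k , succ = k , λ j k≤j → inj₂ (n , m≤n , succ j k≤j)

  glued-branch : ∀ {x} → s ≺ x → Body Glued x → m ≤ x (length s) × Body (Hs (x (length s))) x
  glued-branch {x} s≺x body = proj₁ (above 0) , λ j →
    Hs.tree (proj₁ (above j)) _ (proj₂ (above j)) (restrict x j) (restrict-mono x (m≤n+m j _))
    where
    above : ∀ j → m ≤ x (length s) × Hs (x (length s)) (restrict x (suc (length s) + j))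
    above j = glued-above (body _)
      (⊑-trans (⊑-reflexive (sym (≺⇒restrict-suc s≺x))) (restrict-mono x (m≤m+n _ j)))

module _ (T : List ℕ → List ℕ → Set) (s t : List ℕ) where

  Avoids : (List ℕ → Set) → Set
  Avoids H = ∀ x → A T s t x → Body H x → ⊥

  Refutation : Set₁
  Refutation = Σ (List ℕ → Set) λ H → Hechler H s × Avoids H

  ¬refutation⇒positive : ExcludedMiddle (lsuc 0ℓ) → ¬ Refutation → Positive T s t
  ¬refutation⇒positive em ¬ref H hechler = lower (decidable-stable em λ ¬meets →
    ¬ref (H , hechler , λ x x∈A x∈H → ¬meets (lift (x , x∈A , x∈H))))

  refutingTree : Dec Refutation → List ℕ → Set
  refutingTree (yes (H , _)) = H
  refutingTree (no _)      _ = ⊥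

  refutingTree-avoids : (d : Dec Refutation) → Avoids (refutingTree d)
  refutingTree-avoids (yes (_ , _ , avoids)) = avoids
  refutingTree-avoids (no _) _ _ x∈H = x∈H 0

  refutingTree-hechler : ExcludedMiddle (lsuc 0ℓ) → (d : Dec Refutation) →
                         ¬ Positive T s t → Hechler (refutingTree d) s
  refutingTree-hechler _  (yes (_ , hechler , _)) _ = hechler
  refutingTree-hechler em (no ¬ref) ¬pos = ⊥-elim (¬pos (¬refutation⇒positive em ¬ref))

lemma5 : ExcludedMiddle (lsuc 0ℓ) →
    (T : List ℕ → List ℕ → Set) → PairTree T →
    (s t : List ℕ) → Positive T s t →
    ∀ (m : ℕ) → ∃ λ (n : ℕ) → m ≤ n × Positive T (s ∷ʳ n) t
lemma5 em T _ s t pos m with em {∃ λ n → m ≤ n × Positive T (s ∷ʳ n) t}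
... | yes found = found
... | no ¬found = ⊥-elim impossible
  where
  refutation : ∀ n → Dec (Refutation T (s ∷ʳ n) t)
  refutation n = em

  Hs : ℕ → List ℕ → Set
  Hs n = refutingTree T (s ∷ʳ n) t (refutation n)

  Hs-hechler : ∀ {n} → m ≤ n → Hechler (Hs n) (s ∷ʳ n)
  Hs-hechler {n} m≤n =
    refutingTree-hechler T _ t em (refutation n) λ pos′ → ¬found (n , m≤n , pos′)

  open Gluing s m Hs Hs-hechler

  impossible : ⊥
  impossible with x , (s≺x , witness) , x∈H ← pos Glued glued-hechler =
    refutingTree-avoids T _ t (refutation (x (length s))) x
      (≺-∷ʳ s≺x , witness) (proj₂ (glued-branch s≺x x∈H))
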